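{- Let $p>2$ be a prime and let $[a_0,\dots,a_{t-1}]$ ($t\ge1$) be a finite Browkin continued fraction with $a_0,\dots,a_{t-1}>0$ and $a_{t-1}>\frac4p$. Suppose that $|a_0|_p>1$ and $|a_0|_\infty<\frac p4$, and that there exists an integer $q$ with $\tilde B_{t-1}\mid q\mid\tilde B_{t-1}^2$ whose class modulo $\tilde A_{t-1}^2$ lies in the multiplicative subgroup of $(\mathbb{Z}/\tilde A_{t-1}^2\mathbb{Z})^\times$ generated by the class of $p$. Then $[a_0,\dots,a_{t-1}]$ is nice.
   Context: Let $\mathcal{Y}=\mathbb{Z}[1/p]\cap(-p/2,p/2)$. A finite Browkin continued fraction $[a_0,\dots,a_{t-1}]$ is a sequence of elements of $\mathcal{Y}$ with $|a_i|_p>1$ for $1\le i\le t-1$. Its convergent sequences are $A_{ -1}=1$, $A_0=a_0$, $B_{ -1}=0$, $B_0=1$, $A_n=a_nA_{n-1}+A_{n-2}$, $B_n=a_nB_{n-1}+B_{n-2}$. For nonzero $x\in\mathbb{Z}[1/p]$, $\tilde x=x\,p^{ -v_p(x)}\in\mathbb{Z}$ denotes its prime-to-$p$ part. The finite BCF $[a_0,\dots,a_{t-1}]$ is called nice if: (a) $|a_0|_p>1$ and $|a_0|_\infty<\frac p4$; (b) $\left|\frac{A_{t-1}}{A_{t-2}}\right|_\infty>\frac4p$; (c) there exists an integer $q$ with $\tilde B_{t-1}\mid q\mid\tilde B_{t-1}^2$ such that the class of $q$ modulo $\tilde A_{t-1}^2$ belongs to the multiplicative subgroup generated by the class of $p$.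 -}

module Defs where

open import Data.Nat as ℕ using (ℕ; zero; suc; NonZero)
import Data.Nat.Properties as ℕP
open import Data.Nat.Divisibility as ℕD using ()
open import Data.Nat.Primality using (Prime)
open import Data.Integer as ℤ using (ℤ; +_; -[1+_])
import Data.Integer.Divisibility as ℤD
open import Data.Rational as ℚ using (ℚ; ↧ₙ_; 0ℚ; _<_; ∣_∣; _÷_; _/_)
open import Data.List using (List; []; _∷_; foldl)
open import Data.List.Relation.Unary.All using (All)
open import Data.Product using (Σ; ∃; ∃-syntax; _×_; _,_; proj₁; proj₂)
open import Relation.Binary.PropositionalEquality using (_≡_)
open import Relation.Nullary using (¬_)

-- Throughout, p is a natural number (assumed prime in the theorem) and
-- elements of ℤ[1/p] are represented as rationals (ℚ, always in lowest terms).

ι : ℤ → ℚ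
ι n = n / 1

InZ1/p : ℕ → ℚ → Set
InZ1/p p x = ∃[ k ] (↧ₙ x) ℕD.∣ (p ℕ.^ k)

-- |x|_p > 1 : v_p(x) < 0, i.e. p divides the reduced denominator of x.
PAbsGt1 : ℕ → ℚ → Set
PAbsGt1 p x = p ℕD.∣ (↧ₙ x)

InY : (p : ℕ) → .{{NonZero p}} → ℚ → Set
InY p x = InZ1/p p x × (ℚ.- ((+ p) / 2) < x) × (x < (+ p) / 2)

-- [a₀, a₁, …, a_{t-1}] is a finite Browkin continued fraction; the list is
-- given as a head a₀ and tail (a₁ … a_{t-1}), so t = 1 + length as ≥ 1.
IsBCF : (p : ℕ) → .{{NonZero p}} → ℚ → List ℚ → Set
IsBCF p a₀ as = InY p a₀ × All (InY p) as × All (PAbsGt1 p) as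

-- One step of the recurrence X_n = a_n X_{n-1} + X_{n-2}, acting on the
-- pair (X_{n-1}, X_{n-2}).
step : ℚ × ℚ → ℚ → ℚ × ℚ
step (x₁ , x₂) a = (a ℚ.* x₁ ℚ.+ x₂ , x₁)

-- Running the recurrence over [a₀,…,a_{t-1}] from initial pair (X_{-1}, X_{-2})
-- yields (X_{t-1}, X_{t-2}).
run : ℚ × ℚ → ℚ → List ℚ → ℚ × ℚ
run init a₀ as = foldl step (step init a₀) as

-- (A_{t-1}, A_{t-2}); initial (A_{-1}, A_{-2}) = (1, 0) so that A_0 = a₀.
Apair : ℚ → List ℚ → ℚ × ℚ
Apair = run (ℚ.1ℚ , 0ℚ)

-- (B_{t-1}, B_{t-2}); initial (B_{-1}, B_{-2}) = (0, 1) so that B_0 = 1.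
Bpair : ℚ → List ℚ → ℚ × ℚ
Bpair = run (0ℚ , ℚ.1ℚ)

A-last : ℚ → List ℚ → ℚ
A-last a₀ as = proj₁ (Apair a₀ as)

A-prev : ℚ → List ℚ → ℚ
A-prev a₀ as = proj₂ (Apair a₀ as)

B-last : ℚ → List ℚ → ℚ
B-last a₀ as = proj₁ (Bpair a₀ as)

lastElem : ℚ → List ℚ → ℚ
lastElem a₀ []       = a₀
lastElem a₀ (a ∷ as) = lastElem a as

ppow : (p : ℕ) → .{{NonZero p}} → ℤ → ℚ
ppow p (+ k)      = (+ (p ℕ.^ k)) / 1
ppow p -[1+ k ]   = _/_ (+ 1) (p ℕ.^ suc k) {{ℕP.m^n≢0 p (suc k)}}

-- n = x̃ = x · p^{-v_p(x)} : n is an integer prime to p and x = n · p^e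
-- for some integer e (then necessarily e = v_p(x)).
IsPrimeToPPart : (p : ℕ) → .{{NonZero p}} → ℚ → ℤ → Set
IsPrimeToPPart p x n = (¬ (p ℕD.∣ ℤ.∣ n ∣)) × ∃[ e ] (x ≡ ι n ℚ.* ppow p e)

CondA : (p : ℕ) → .{{NonZero p}} → ℚ → Set
CondA p a₀ = PAbsGt1 p a₀ × (∣ a₀ ∣ < (+ p) / 4)

CondB : (p : ℕ) → .{{NonZero p}} → ℚ → List ℚ → Set
CondB p a₀ as =
  Σ (ℚ.NonZero (A-prev a₀ as)) λ nz →
    (+ 4) / p < ∣ _÷_ (A-last a₀ as) (A-prev a₀ as) {{nz}} ∣

-- Condition (c): there is an integer q with B̃_{t-1} ∣ q ∣ B̃_{t-1}² whose class
-- modulo Ã_{t-1}² lies in the subgroup generated by the class of p, i.e.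
-- q ≡ p^k (mod Ã_{t-1}²) for some k ≥ 0 (the subgroup of a finite group
-- generated by an element consists of its non-negative powers).
CondC : (p : ℕ) → .{{NonZero p}} → ℚ → List ℚ → Set
CondC p a₀ as =
  ∃[ Ã ] ∃[ B̃ ] IsPrimeToPPart p (A-last a₀ as) Ã × IsPrimeToPPart p (B-last a₀ as) B̃ ×
    ∃[ q ] (B̃ ℤD.∣ q) × (q ℤD.∣ (B̃ ℤ.* B̃)) ×
      ∃[ k ] ((Ã ℤ.* Ã) ℤD.∣ (q ℤ.- ((+ p) ℤ.^ k)))

Nice : (p : ℕ) → .{{NonZero p}} → ℚ → List ℚ → Set
Nice p a₀ as = CondA p a₀ × CondB p a₀ as × CondC p a₀ as

{-# OPTIONS --safe #-}
-- Conditions (a) and (c) are hypotheses, so only (b) needs proof. All partial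
-- quotients being positive, every convergent numerator A_n (n ≥ 0) is positive,
-- and A_{t-1} / A_{t-2} = a_{t-1} + A_{t-3} / A_{t-2} ≥ a_{t-1} > 4/p.
module Submission where

open import Defs
open import Data.Nat using (ℕ; NonZero; _>_)
open import Data.Nat.Primality using (Prime)
open import Data.Integer using (+_)
import Data.Rational as ℚ
open import Data.Rational
  using (ℚ; 0ℚ; 1ℚ; _<_; _≤_; _/_; _+_; _*_; _÷_; 1/_; ∣_∣; Positive; positive; nonNegative)
open import Data.Rational.Properties
open import Data.List using (List; []; _∷_; foldl)
open import Data.List.Relation.Unary.All using (All; []; _∷_)
open import Data.Product using (Σ; ∃-syntax; _×_; _,_; proj₁; proj₂)
open import Relation.Binary.PropositionalEquality using (_≡_; refl; sym; cong; subst; module ≡-Reasoning)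

PositivePair : ℚ × ℚ → Set
PositivePair (x₁ , x₂) = 0ℚ < x₁ × 0ℚ ≤ x₂

step-positivePair : ∀ {x} a → 0ℚ < a → PositivePair x → PositivePair (step x a)
step-positivePair {x₁ , x₂} a 0<a (0<x₁ , 0≤x₂) =
  positive⁻¹ _ {{pos+nonNeg⇒pos (a * x₁) {{pos*pos⇒pos a x₁}} x₂}} , <⇒≤ 0<x₁
  where instance
    _ = positive 0<a
    _ = positive 0<x₁
    _ = nonNegative 0≤x₂

-- The pair z is (X_{t-2}, X_{t-3}), so that the result is (X_{t-1}, X_{t-2}).
foldl-step-lastElem : ∀ x a₀ as → PositivePair x → All (0ℚ <_) (a₀ ∷ as) →
  ∃[ z ] PositivePair z × foldl step (step x a₀) as ≡ step z (lastElem a₀ as)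
foldl-step-lastElem x a₀ []       pos-x _             = x , pos-x , refl
foldl-step-lastElem x a₀ (a ∷ as) pos-x (0<a₀ ∷ 0<as) =
  foldl-step-lastElem (step x a₀) a as (step-positivePair a₀ 0<a₀ pos-x) 0<as

lastElem-positive : ∀ a₀ as → All (0ℚ <_) (a₀ ∷ as) → 0ℚ < lastElem a₀ as
lastElem-positive a₀ []       (0<a₀ ∷ _)     = 0<a₀
lastElem-positive a₀ (a ∷ as) (_    ∷ 0<as) = lastElem-positive a as 0<as

≤-step-ratio : ∀ a x₁ x₂ .{{_ : Positive x₁}} → 0ℚ ≤ x₂ →
  a ≤ _÷_ (a * x₁ + x₂) x₁ {{pos⇒nonZero x₁}}
≤-step-ratio a x₁ x₂ 0≤x₂ = subst (a ≤_) (sym ratio≡) a≤a+x₂/x₁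
  where
  instance
    _ = pos⇒nonZero x₁
    _ = 1/pos⇒pos x₁
    _ = nonNegative 0≤x₂
  open ≡-Reasoning
  ratio≡ : (a * x₁ + x₂) ÷ x₁ ≡ a + x₂ ÷ x₁
  ratio≡ = begin
    (a * x₁ + x₂) * 1/ x₁        ≡⟨ *-distribʳ-+ (1/ x₁) (a * x₁) x₂ ⟩
    a * x₁ * 1/ x₁ + x₂ ÷ x₁     ≡⟨ cong (_+ x₂ ÷ x₁) (*-assoc a x₁ (1/ x₁)) ⟩
    a * (x₁ * 1/ x₁) + x₂ ÷ x₁   ≡⟨ cong (_+ x₂ ÷ x₁) (cong (a *_) (*-inverseʳ x₁)) ⟩
    a * 1ℚ + x₂ ÷ x₁             ≡⟨ cong (_+ x₂ ÷ x₁) (*-identityʳ a) ⟩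
    a + x₂ ÷ x₁                  ∎
  a≤a+x₂/x₁ : a ≤ a + x₂ ÷ x₁
  a≤a+x₂/x₁ = subst (_≤ a + x₂ ÷ x₁) (+-identityʳ a)
    (+-monoʳ-≤ a (nonNegative⁻¹ _ {{nonNeg*nonNeg⇒nonNeg x₂ (1/ x₁) {{pos⇒nonNeg (1/ x₁)}}}}))

RatioExceeds : ℚ → ℚ × ℚ → Set
RatioExceeds r y = Σ (ℚ.NonZero (proj₂ y)) λ nz → r < ∣ _÷_ (proj₁ y) (proj₂ y) {{nz}} ∣

step-ratioExceeds : ∀ {x r} a → 0ℚ < a → r < a → PositivePair x → RatioExceeds r (step x a)
step-ratioExceeds {x₁ , x₂} {r} a 0<a r<a (0<x₁ , 0≤x₂) =
  pos⇒nonZero x₁ , subst (r <_) (sym (0≤p⇒∣p∣≡p (≤-trans (<⇒≤ 0<a) a≤ratio))) (<-≤-trans r<a a≤ratio)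
  where
  instance
    _ = positive 0<x₁
    _ = pos⇒nonZero x₁
  a≤ratio : a ≤ (a * x₁ + x₂) ÷ x₁
  a≤ratio = ≤-step-ratio a x₁ x₂ 0≤x₂

proposition5p4 : (p : ℕ) → Prime p → p > 2 → .{{_ : NonZero p}} →
    (a₀ : ℚ) (as : List ℚ) → IsBCF p a₀ as →
    All (λ a → 0ℚ < a) (a₀ ∷ as) →
    (+ 4) / p < lastElem a₀ as →
    CondA p a₀ →
    CondC p a₀ as →
    Nice p a₀ as
proposition5p4 p _ _ a₀ as _ 0<aᵢ 4/p<aₜ₋₁ condA condC
  with foldl-step-lastElem (1ℚ , 0ℚ) a₀ as (positive⁻¹ 1ℚ , ≤-refl) 0<aᵢ
... | _ , positive-z , run≡ = condA , condB , condC
  where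
  condB : CondB p a₀ as
  condB = subst (RatioExceeds ((+ 4) / p)) (sym run≡)
    (step-ratioExceeds (lastElem a₀ as) (lastElem-positive a₀ as 0<aᵢ) 4/p<aₜ₋₁ positive-z)
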